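{- Let $\delta \in (0,1)$, let $H$ be an $n$-vertex graph, let $C$ be a set of colours with $|C| \geq 7\delta n$, and for every $w \in V(H)$ let $C_w \subseteq C$, such that: (i) for every $w \in V(H)$, $d_H(w) \leq |C| - |C_w|$; (ii) there is a set $U \subseteq V(H)$ with $|U| \leq \delta n$ such that every edge of $H$ is incident to a vertex of $U$; (iii) for every $w \in V(H)$, $|C_w| \leq \delta n$; (iv) for every $c \in C$, $|\{w \in V(H) : c \in C_w\}| \leq \delta n$. Then there exists a proper edge-colouring $\phi : E(H) \to C$ such that every edge $uv \in E(H)$ satisfies $\phi(uv) \notin C_u \cup C_v$.
   Context: A proper edge-colouring of a graph assigns colours to edges so that edges sharing a vertex receive different colours. $d_H(w)$ is the degree of $w$ in $H$. -}

module Defs where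

open import Data.Nat using (ℕ; _*_; _≤_; _<_)
open import Data.Fin using (Fin)
open import Data.Fin.Subset using (Subset; _∈_; _∉_; ∣_∣)
open import Data.Vec using (tabulate; lookup)
open import Data.Sum using (_⊎_)
open import Data.Product using (_×_)
open import Relation.Binary.PropositionalEquality using (_≡_; _≢_)

record Graph (n : ℕ) : Set where
  field
    adj   : Fin n → Subset n
    sym   : ∀ u v → v ∈ adj u → u ∈ adj v
    irrefl : ∀ u → u ∉ adj u

open Graph public

_~[_]_ : ∀ {n} → Fin n → Graph n → Fin n → Set
u ~[ H ] v = v ∈ adj H u

deg : ∀ {n} → Graph n → Fin n → ℕ
deg H w = ∣ adj H w ∣

holders : ∀ {n k} → (Fin n → Subset k) → Fin k → ℕ
holders Cs c = ∣ tabulate (λ w → lookup (Cs w) c) ∣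

-- An edge-colouring of H with colour set Fin k, given as a function on
-- ordered pairs; only its values on edges matter, where it is required
-- to be symmetric (so it is a function on E(H)).
IsEdgeColouring : ∀ {n k} → Graph n → (Fin n → Fin n → Fin k) → Set
IsEdgeColouring H φ = ∀ u v → u ~[ H ] v → φ u v ≡ φ v u

IsProper : ∀ {n k} → Graph n → (Fin n → Fin n → Fin k) → Set
IsProper H φ = ∀ u v v' → u ~[ H ] v → u ~[ H ] v' → v ≢ v' → φ u v ≢ φ u v'

Avoids : ∀ {n k} → Graph n → (Fin n → Subset k) → (Fin n → Fin n → Fin k) → Set
Avoids H Cs φ = ∀ u v → u ~[ H ] v → (φ u v ∉ Cs u) × (φ u v ∉ Cs v)

module Submission where

-- Colour the edges at U vertex by vertex, keeping a partial proper colouring whose coloured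
-- edges all have an endpoint among the vertices already treated (which lie in U). To colour an
-- edge uv from the current vertex u to an untreated vertex v, take a colour r ∉ C_u missing at u
-- (u has fewer than |C| − |C_u| other edges), then a colour c ∉ C_u outside a blocked set of at
-- most 5δn colours: C_v, the colours at v (all on edges into U), and the colours of the edges uv'
-- with v' ∈ U, or v' joined by an r-edge to U, or r ∈ C_v'. As |C ∖ C_u| ≥ 6δn, such a c exists.
-- If c is missing at u, colour uv with c; otherwise recolour the c-edge uv' with r, which is
-- legal at both ends, and then colour uv with c.

open import Defs hiding (sym)
open import Data.Empty using (⊥-elim)
open import Data.Fin using (Fin; zero; suc; _≟_; fromℕ<)
open import Data.Fin.Properties using (any?)
open import Data.Fin.Subset
  using (Subset; _∈_; _∉_; ∣_∣; _∪_; ⁅_⁆; ∁; _-_; inside; outside)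
  renaming (⊥ to ∅)
open import Data.Fin.Subset.Properties
  using (_∈?_; ∣⊥∣≡0; ∣⁅x⁆∣≡1; ∣p∣≤∣x∷p∣; ∣∁p∣≡n∸∣p∣; x∈⁅x⁆; p⊆p∪q; q⊆p∪q;
         drop-there; x∈p∧x≢y⇒x∈p-y; x∈p⇒∣p-x∣<∣p∣; x∈∁p⇒x∉p)
open import Data.List using (List; []; _∷_; allFin; filter)
open import Data.List.Membership.Propositional using () renaming (_∈_ to _∈ᴸ_)
open import Data.List.Membership.Propositional.Properties using (∈-allFin; ∈-filter⁺)
open import Data.List.Relation.Unary.All as All using (All; []; _∷_)
open import Data.List.Relation.Unary.All.Properties using (all-filter)
open import Data.List.Relation.Unary.Any using (here; there)
open import Data.Maybe using (Maybe; just; nothing; maybe′; fromMaybe)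
open import Data.Maybe.Properties using (just-injective) renaming (≡-dec to ≡-dec-Maybe)
open import Data.Nat using (ℕ; zero; suc; _*_; _+_; _≤_; _<_; _∸_; z≤n; s≤s; s≤s⁻¹)
open import Data.Nat.Properties hiding (_≟_)
open import Data.Product using (Σ; _×_; _,_; ∃)
open import Data.Sum using (_⊎_; inj₁; inj₂) renaming (map to ⊎-map; swap to ⊎-swap)
open import Data.Vec using (_∷_; []; tabulate; lookup; here; there)
open import Data.Vec.Properties using (lookup∘tabulate; []=⇒lookup; lookup⇒[]=)
open import Function using (_∘_; case_of_)
open import Relation.Binary.PropositionalEquality using (_≡_; _≢_; refl; sym; trans; cong; subst)
open import Relation.Nullary using (¬_; Dec; yes; no)
open import Relation.Nullary.Decidable using (_×-dec_; _⊎-dec_)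

∣p∪q∣≤∣p∣+∣q∣ : ∀ {n} (p q : Subset n) → ∣ p ∪ q ∣ ≤ ∣ p ∣ + ∣ q ∣
∣p∪q∣≤∣p∣+∣q∣ []            []            = z≤n
∣p∪q∣≤∣p∣+∣q∣ (outside ∷ p) (outside ∷ q) = ∣p∪q∣≤∣p∣+∣q∣ p q
∣p∪q∣≤∣p∣+∣q∣ (outside ∷ p) (inside ∷ q)  =
  ≤-trans (s≤s (∣p∪q∣≤∣p∣+∣q∣ p q)) (≤-reflexive (sym (+-suc ∣ p ∣ ∣ q ∣)))
∣p∪q∣≤∣p∣+∣q∣ (inside ∷ p)  (s ∷ q)       =
  s≤s (≤-trans (∣p∪q∣≤∣p∣+∣q∣ p q) (+-monoʳ-≤ ∣ p ∣ (∣p∣≤∣x∷p∣ s q)))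

∃∈q∖p-∷ : ∀ {n s t} {p q : Subset n} → (∃ λ x → x ∈ q × x ∉ p) → ∃ λ x → x ∈ t ∷ q × x ∉ s ∷ p
∃∈q∖p-∷ (x , x∈q , x∉p) = suc x , there x∈q , x∉p ∘ drop-there

∣p∣<∣q∣⇒∃∈q∖p : ∀ {n} {p q : Subset n} → ∣ p ∣ < ∣ q ∣ → ∃ λ x → x ∈ q × x ∉ p
∣p∣<∣q∣⇒∃∈q∖p {p = []}          {[]}          ()
∣p∣<∣q∣⇒∃∈q∖p {p = outside ∷ p} {inside ∷ q}  _  = zero , here , λ ()
∣p∣<∣q∣⇒∃∈q∖p {p = outside ∷ p} {outside ∷ q} lt = ∃∈q∖p-∷ (∣p∣<∣q∣⇒∃∈q∖p lt)
∣p∣<∣q∣⇒∃∈q∖p {p = inside ∷ p}  {inside ∷ q}  lt = ∃∈q∖p-∷ (∣p∣<∣q∣⇒∃∈q∖p (s≤s⁻¹ lt))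
∣p∣<∣q∣⇒∃∈q∖p {p = inside ∷ p}  {outside ∷ q} lt = ∃∈q∖p-∷ (∣p∣<∣q∣⇒∃∈q∖p (<⇒≤ lt))

∣p∪q∣≤m+n : ∀ {n m o} (p q : Subset n) → ∣ p ∣ ≤ m → ∣ q ∣ ≤ o → ∣ p ∪ q ∣ ≤ m + o
∣p∪q∣≤m+n p q ∣p∣≤m ∣q∣≤o = ≤-trans (∣p∪q∣≤∣p∣+∣q∣ p q) (+-mono-≤ ∣p∣≤m ∣q∣≤o)

image : ∀ {n m} → Subset n → (Fin n → Maybe (Fin m)) → Subset m
image []            g = ∅
image (outside ∷ W) g = image W (g ∘ suc)
image (inside ∷ W)  g = maybe′ ⁅_⁆ ∅ (g zero) ∪ image W (g ∘ suc)

∣image∣≤∣W∣ : ∀ {n m} (W : Subset n) (g : Fin n → Maybe (Fin m)) → ∣ image W g ∣ ≤ ∣ W ∣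
∣image∣≤∣W∣ {m = m} [] g = ≤-reflexive (∣⊥∣≡0 m)
∣image∣≤∣W∣ (outside ∷ W) g = ∣image∣≤∣W∣ W (g ∘ suc)
∣image∣≤∣W∣ {m = m} (inside ∷ W) g =
  ∣p∪q∣≤m+n (maybe′ ⁅_⁆ ∅ (g zero)) (image W (g ∘ suc)) (∣value∣≤1 (g zero)) (∣image∣≤∣W∣ W (g ∘ suc))
  where
  ∣value∣≤1 : (o : Maybe (Fin m)) → ∣ maybe′ ⁅_⁆ ∅ o ∣ ≤ 1
  ∣value∣≤1 (just c) = ≤-reflexive (∣⁅x⁆∣≡1 c)
  ∣value∣≤1 nothing   = ≤-trans (≤-reflexive (∣⊥∣≡0 m)) z≤n

image⁺ : ∀ {n m} {W : Subset n} {g : Fin n → Maybe (Fin m)} {w c} → w ∈ W → g w ≡ just c → c ∈ image W g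
image⁺ {W = inside ∷ W}  {c = c} here gw≡c rewrite gw≡c = p⊆p∪q (image W _) (x∈⁅x⁆ c)
image⁺ {W = outside ∷ W} (there w∈W) gw≡c = image⁺ w∈W gw≡c
image⁺ {W = inside ∷ W}  (there w∈W) gw≡c = q⊆p∪q _ _ (image⁺ w∈W gw≡c)

holderSet : ∀ {n k} → (Fin n → Subset k) → Fin k → Subset n
holderSet Cs c = tabulate (λ w → lookup (Cs w) c)

holderSet⁺ : ∀ {n k} {Cs : Fin n → Subset k} {c w} → c ∈ Cs w → w ∈ holderSet Cs c
holderSet⁺ {Cs = Cs} {c} {w} c∈Cs =
  lookup⇒[]= w _ (trans (lookup∘tabulate (λ w → lookup (Cs w) c) w) ([]=⇒lookup c∈Cs))

module _ {n : ℕ} where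

  SamePair : Fin n → Fin n → Fin n → Fin n → Set
  SamePair x y a b = (a ≡ x × b ≡ y) ⊎ (a ≡ y × b ≡ x)

  samePair? : ∀ x y a b → Dec (SamePair x y a b)
  samePair? x y a b = ((a ≟ x) ×-dec (b ≟ y)) ⊎-dec ((a ≟ y) ×-dec (b ≟ x))

  SamePair-swap : ∀ {x y a b} → SamePair x y a b → SamePair x y b a
  SamePair-swap (inj₁ (a≡x , b≡y)) = inj₂ (b≡y , a≡x)
  SamePair-swap (inj₂ (a≡y , b≡x)) = inj₁ (b≡x , a≡y)

  SamePair-functional : ∀ {x y a b b'} → SamePair x y a b → SamePair x y a b' → b ≡ b'
  SamePair-functional (inj₁ (refl , refl)) (inj₁ (_ , refl))    = refl
  SamePair-functional (inj₁ (refl , refl)) (inj₂ (refl , refl)) = refl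
  SamePair-functional (inj₂ (refl , refl)) (inj₁ (refl , refl)) = refl
  SamePair-functional (inj₂ (refl , refl)) (inj₂ (_ , refl))    = refl

PartialColouring : ℕ → ℕ → Set
PartialColouring n k = Fin n → Fin n → Maybe (Fin k)

module _ {n k : ℕ} where

  Coloured : PartialColouring n k → Fin n → Fin n → Set
  Coloured col a b = ∃ λ c → col a b ≡ just c

  _⊑_ : PartialColouring n k → PartialColouring n k → Set
  col ⊑ col' = ∀ a b → Coloured col a b → Coloured col' a b

  ⊑-refl : ∀ {col} → col ⊑ col
  ⊑-refl _ _ ab-coloured = ab-coloured

  ⊑-trans : ∀ {col col' col''} → col ⊑ col' → col' ⊑ col'' → col ⊑ col''
  ⊑-trans col⊑col' col'⊑col'' a b ab-coloured = col'⊑col'' a b (col⊑col' a b ab-coloured)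

  Missing : PartialColouring n k → Fin n → Fin k → Set
  Missing col x e = ∀ z → col x z ≢ just e

  assign : PartialColouring n k → Fin n → Fin n → Fin k → PartialColouring n k
  assign col x y e a b with samePair? x y a b
  ... | yes _ = just e
  ... | no  _ = col a b

  assign-colours : ∀ col x y e → assign col x y e x y ≡ just e
  assign-colours col x y e with samePair? x y x y
  ... | yes _    = refl
  ... | no ¬same = ⊥-elim (¬same (inj₁ (refl , refl)))

  ⊑-assign : ∀ {col x y e} → col ⊑ assign col x y e
  ⊑-assign {col} {x} {y} {e} a b ab-coloured with samePair? x y a b
  ... | yes _ = e , refl
  ... | no  _ = ab-coloured

  Missing-assign : ∀ {col x y e a c} → (∀ {z} → col a z ≡ just c → SamePair x y a z) → c ≢ e →
                   Missing (assign col x y e) a c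
  Missing-assign {col} {x} {y} {e} {a} only-xy c≢e z az≡c with samePair? x y a z
  ... | yes _    = c≢e (sym (just-injective az≡c))
  ... | no ¬same = ¬same (only-xy az≡c)

  partner : PartialColouring n k → Fin k → Fin n → Maybe (Fin n)
  partner col r w with any? (λ x → ≡-dec-Maybe _≟_ (col w x) (just r))
  ... | yes (x , _) = just x
  ... | no  _       = nothing

record Admissible {n k} (H : Graph n) (Cs : Fin n → Subset k) (P : Fin n → Set)
                  (col : PartialColouring n k) : Set where
  field
    symmetric : ∀ a b → col a b ≡ col b a
    on-edges  : ∀ {a b c} → col a b ≡ just c → a ~[ H ] b
    proper    : ∀ {a b b' c} → col a b ≡ just c → col a b' ≡ just c → b ≡ b'
    avoids    : ∀ {a b c} → col a b ≡ just c → c ∉ Cs a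
    anchored  : ∀ {a b c} → col a b ≡ just c → P a ⊎ P b

Covers : ∀ {n k} → Graph n → (Fin n → Set) → PartialColouring n k → Set
Covers H P col = ∀ {a b} → a ~[ H ] b → P a → Coloured col a b

module _ {n k : ℕ} {H : Graph n} {Cs : Fin n → Subset k} where

  empty-admissible : ∀ {P} → Admissible H Cs P (λ _ _ → nothing)
  empty-admissible = record
    { symmetric = λ _ _ → refl ; on-edges = λ () ; proper = λ () ; avoids = λ () ; anchored = λ () }

  module _ {P : Fin n → Set} {col : PartialColouring n k} (adm : Admissible H Cs P col) where
    open Admissible adm

    Admissible-anchor-mono : ∀ {Q : Fin n → Set} → (∀ {x} → P x → Q x) → Admissible H Cs Q col
    Admissible-anchor-mono P⊆Q = record
      { symmetric = symmetric ; on-edges = on-edges ; proper = proper ; avoids = avoids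
      ; anchored = ⊎-map P⊆Q P⊆Q ∘ anchored }

    Coloured-swap : ∀ {a b} → Coloured col a b → Coloured col b a
    Coloured-swap {a} {b} (c , ab≡c) = c , trans (symmetric b a) ab≡c

    partner-spec : ∀ {w x r} → col w x ≡ just r → partner col r w ≡ just x
    partner-spec {w} {x} {r} wx≡r with any? (λ x → ≡-dec-Maybe _≟_ (col w x) (just r))
    ... | yes (x' , wx'≡r) = cong just (proper wx'≡r wx≡r)
    ... | no none          = ⊥-elim (none (x , wx≡r))

    assign-admissible : ∀ {x y e} → x ~[ H ] y → e ∉ Cs x → e ∉ Cs y →
                        Missing col x e → Missing col y e → P x ⊎ P y →
                        Admissible H Cs P (assign col x y e)
    assign-admissible {x} {y} {e} x~y e∉Csx e∉Csy x-missing y-missing Px⊎Py = record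
      { symmetric = symmetric′
      ; on-edges  = λ {a} {b} → on-edges′ {a} {b}
      ; proper    = λ {a} {b} {b'} → proper′ {a} {b} {b'}
      ; avoids    = λ {a} {b} → avoids′ {a} {b}
      ; anchored  = λ {a} {b} → anchored′ {a} {b}
      }
      where
      col′ : PartialColouring n k
      col′ = assign col x y e

      missing-on-pair : ∀ {a b} → SamePair x y a b → Missing col a e
      missing-on-pair (inj₁ (refl , _)) = x-missing
      missing-on-pair (inj₂ (refl , _)) = y-missing

      symmetric′ : ∀ a b → col′ a b ≡ col′ b a
      symmetric′ a b with samePair? x y a b | samePair? x y b a
      ... | yes _    | yes _    = refl
      ... | yes same | no ¬same = ⊥-elim (¬same (SamePair-swap same))
      ... | no ¬same | yes same = ⊥-elim (¬same (SamePair-swap same))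
      ... | no _     | no _     = symmetric a b

      on-edges′ : ∀ {a b c} → col′ a b ≡ just c → a ~[ H ] b
      on-edges′ {a} {b} ab≡c with samePair? x y a b
      ... | yes (inj₁ (refl , refl)) = x~y
      ... | yes (inj₂ (refl , refl)) = Graph.sym H x y x~y
      ... | no _                     = on-edges ab≡c

      proper′ : ∀ {a b b' c} → col′ a b ≡ just c → col′ a b' ≡ just c → b ≡ b'
      proper′ {a} {b} {b'} ab≡c ab'≡c with samePair? x y a b | samePair? x y a b'
      proper′ _    _     | yes same | yes same' = SamePair-functional same same'
      proper′ refl ab'≡c | yes same | no _      = ⊥-elim (missing-on-pair same _ ab'≡c)
      proper′ ab≡c refl  | no _     | yes same' = ⊥-elim (missing-on-pair same' _ ab≡c)
      proper′ ab≡c ab'≡c | no _     | no _      = proper ab≡c ab'≡c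

      avoids′ : ∀ {a b c} → col′ a b ≡ just c → c ∉ Cs a
      avoids′ {a} {b} ab≡c with samePair? x y a b
      avoids′ {a} {b} refl | yes (inj₁ (refl , _)) = e∉Csx
      avoids′ {a} {b} refl | yes (inj₂ (refl , _)) = e∉Csy
      avoids′ {a} {b} ab≡c | no _                = avoids ab≡c

      anchored′ : ∀ {a b c} → col′ a b ≡ just c → P a ⊎ P b
      anchored′ {a} {b} ab≡c with samePair? x y a b
      ... | yes (inj₁ (refl , refl)) = Px⊎Py
      ... | yes (inj₂ (refl , refl)) = ⊎-swap Px⊎Py
      ... | no _                     = anchored ab≡c

  complete-colouring : ∀ {P col} → Fin k → Admissible H Cs P col →
    (∀ {u v} → u ~[ H ] v → Coloured col u v) →
    Σ (Fin n → Fin n → Fin k) (λ φ → IsEdgeColouring H φ × IsProper H φ × Avoids H Cs φ)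
  complete-colouring {P} {col} c₀ adm total =
    φ , (λ u v u~v →
           just-injective (trans (sym (colour u~v)) (trans (symmetric u v) (colour (Graph.sym H u v u~v)))))
      , (λ u v v' u~v u~v' v≢v' φuv≡φuv' →
           v≢v' (proper (colour u~v) (trans (colour u~v') (cong just (sym φuv≡φuv')))))
      , (λ u v u~v → avoids (colour u~v) , avoids (trans (symmetric v u) (colour u~v)))
    where
    open Admissible adm
    φ : Fin n → Fin n → Fin k
    φ a b = fromMaybe c₀ (col a b)
    colour : ∀ {a b} → a ~[ H ] b → col a b ≡ just (φ a b)
    colour {a} {b} a~b with col a b | total a~b
    ... | just _  | _       = refl
    ... | nothing | (_ , ())

module Construction
  {n k : ℕ} (H : Graph n) (Cs : Fin n → Subset k) (U : Subset n) (q δn : ℕ)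
  (δn>0 : 0 < δn) (7δn≤qk : 7 * δn ≤ q * k)
  (U-small : q * ∣ U ∣ ≤ δn) (Cs-small : ∀ w → q * ∣ Cs w ∣ ≤ δn)
  (holders-small : ∀ c → q * holders Cs c ≤ δn)
  (deg≤ : ∀ w → deg H w ≤ k ∸ ∣ Cs w ∣)
  where

  6δn≤q∣∁Cs∣ : ∀ w → 6 * δn ≤ q * ∣ ∁ (Cs w) ∣
  6δn≤q∣∁Cs∣ w = begin
    6 * δn                 ≤⟨ m+n≤o⇒m≤o∸n (6 * δn) 6δn+q∣Cs∣≤qk ⟩
    q * k ∸ q * ∣ Cs w ∣   ≡⟨ *-distribˡ-∸ q k ∣ Cs w ∣ ⟨
    q * (k ∸ ∣ Cs w ∣)     ≡⟨ cong (q *_) (∣∁p∣≡n∸∣p∣ (Cs w)) ⟨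
    q * ∣ ∁ (Cs w) ∣       ∎
    where
    open ≤-Reasoning
    6δn+q∣Cs∣≤qk : 6 * δn + q * ∣ Cs w ∣ ≤ q * k
    6δn+q∣Cs∣≤qk = begin
      6 * δn + q * ∣ Cs w ∣ ≤⟨ +-monoʳ-≤ (6 * δn) (Cs-small w) ⟩
      6 * δn + δn           ≡⟨ +-comm (6 * δn) δn ⟩
      7 * δn                ≤⟨ 7δn≤qk ⟩
      q * k                 ∎

  fewer-than-free : ∀ {X : Subset k} w → q * ∣ X ∣ ≤ 5 * δn → ∣ X ∣ < ∣ ∁ (Cs w) ∣
  fewer-than-free {X} w q∣X∣≤5δn = *-cancelˡ-< q ∣ X ∣ ∣ ∁ (Cs w) ∣ (begin-strict
    q * ∣ X ∣          ≤⟨ q∣X∣≤5δn ⟩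
    5 * δn             <⟨ m<n+m (5 * δn) δn>0 ⟩
    6 * δn             ≤⟨ 6δn≤q∣∁Cs∣ w ⟩
    q * ∣ ∁ (Cs w) ∣   ∎)
    where open ≤-Reasoning

  some-colour : Fin k
  some-colour = fromℕ< (*-cancelˡ-< q 0 k (begin-strict
    q * 0     ≡⟨ *-zeroʳ q ⟩
    0         <⟨ δn>0 ⟩
    δn        ≤⟨ m≤m+n δn (6 * δn) ⟩
    7 * δn    ≤⟨ 7δn≤qk ⟩
    q * k     ∎))
    where open ≤-Reasoning

  *-+-≤ : ∀ {x y a b} → q * x ≤ a → q * y ≤ b → q * (x + y) ≤ a + b
  *-+-≤ {x} {y} qx≤a qy≤b = ≤-trans (≤-reflexive (*-distribˡ-+ q x y)) (+-mono-≤ qx≤a qy≤b)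

  Extension : (Fin n → Set) → PartialColouring n k → Fin n → Fin n → Set
  Extension P col u v = ∃ λ col' → Admissible H Cs P col' × col ⊑ col' × Coloured col' u v

  module _ {P : Fin n → Set} (P⊆U : ∀ {x} → P x → x ∈ U)
           {col : PartialColouring n k} (adm : Admissible H Cs P col)
           {u v : Fin n} (u~v : u ~[ H ] v) (Pu : P u) (¬Pv : ¬ P v) (uv-uncoloured : col u v ≡ nothing)
           where
    open Admissible adm

    used-at-u : Subset k
    used-at-u = image (adj H u - v) (col u)

    unused⇒missing : ∀ {e} → e ∉ used-at-u → Missing col u e
    unused⇒missing e∉used z uz≡e =
      e∉used (image⁺ {g = col u} (x∈p∧x≢y⇒x∈p-y (on-edges uz≡e) z≢v) uz≡e)
      where
      z≢v : z ≢ v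
      z≢v refl = case trans (sym uz≡e) uv-uncoloured of λ ()

    ∣used-at-u∣<∣free∣ : ∣ used-at-u ∣ < ∣ ∁ (Cs u) ∣
    ∣used-at-u∣<∣free∣ = begin-strict
      ∣ used-at-u ∣     ≤⟨ ∣image∣≤∣W∣ (adj H u - v) (col u) ⟩
      ∣ adj H u - v ∣   <⟨ x∈p⇒∣p-x∣<∣p∣ u~v ⟩
      deg H u           ≤⟨ deg≤ u ⟩
      k ∸ ∣ Cs u ∣      ≡⟨ ∣∁p∣≡n∸∣p∣ (Cs u) ⟨
      ∣ ∁ (Cs u) ∣      ∎
      where open ≤-Reasoning

    -- the endpoints v' for which the edge uv' might not be recolourable with r
    unsafe : Fin k → Subset n
    unsafe r = U ∪ image U (partner col r) ∪ holderSet Cs r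

    blocked : Fin k → Subset k
    blocked r = Cs v ∪ image U (col v) ∪ image (unsafe r) (col u)

    ∣blocked∣<∣free∣ : ∀ r → ∣ blocked r ∣ < ∣ ∁ (Cs u) ∣
    ∣blocked∣<∣free∣ r = fewer-than-free {X = blocked r} u (begin
      q * ∣ blocked r ∣                  ≤⟨ *-monoʳ-≤ q ∣blocked∣≤ ⟩
      q * (∣ Cs v ∣ + (∣ U ∣ + (∣ U ∣ + (∣ U ∣ + holders Cs r))))
                                         ≤⟨ q*-bound ⟩
      δn + (δn + (δn + (δn + δn)))       ≡⟨ cong (λ t → δn + (δn + (δn + (δn + t)))) (+-identityʳ δn) ⟨
      5 * δn                             ∎)
      where
      open ≤-Reasoning
      ∣unsafe∣≤ : ∣ unsafe r ∣ ≤ ∣ U ∣ + (∣ U ∣ + holders Cs r)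
      ∣unsafe∣≤ = ∣p∪q∣≤m+n U _ ≤-refl
        (∣p∪q∣≤m+n (image U (partner col r)) (holderSet Cs r) (∣image∣≤∣W∣ U (partner col r)) ≤-refl)
      ∣blocked∣≤ : ∣ blocked r ∣ ≤ ∣ Cs v ∣ + (∣ U ∣ + (∣ U ∣ + (∣ U ∣ + holders Cs r)))
      ∣blocked∣≤ = ∣p∪q∣≤m+n (Cs v) _ ≤-refl (∣p∪q∣≤m+n (image U (col v)) (image (unsafe r) (col u))
        (∣image∣≤∣W∣ U (col v)) (≤-trans (∣image∣≤∣W∣ (unsafe r) (col u)) ∣unsafe∣≤))
      q*-bound : q * (∣ Cs v ∣ + (∣ U ∣ + (∣ U ∣ + (∣ U ∣ + holders Cs r)))) ≤ δn + (δn + (δn + (δn + δn)))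
      q*-bound = *-+-≤ (Cs-small v) (*-+-≤ U-small (*-+-≤ U-small (*-+-≤ U-small (holders-small r))))

    blocked⁺ : ∀ {r x c} → x ∈ unsafe r → col u x ≡ just c → c ∈ blocked r
    blocked⁺ {r} x∈unsafe ux≡c =
      q⊆p∪q (Cs v) _ (q⊆p∪q (image U (col v)) _ (image⁺ {W = unsafe r} {g = col u} x∈unsafe ux≡c))

    unsafe⁺ : ∀ {r x} → x ∈ U ⊎ x ∈ image U (partner col r) ⊎ r ∈ Cs x → x ∈ unsafe r
    unsafe⁺ (inj₁ x∈U)              = p⊆p∪q _ x∈U
    unsafe⁺ (inj₂ (inj₁ x-partner)) = q⊆p∪q U _ (p⊆p∪q _ x-partner)
    unsafe⁺ {r} (inj₂ (inj₂ r∈Csx)) = q⊆p∪q U _ (q⊆p∪q _ _ (holderSet⁺ {Cs = Cs} r∈Csx))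

    module _ {r c : Fin k} (r∉Csu : r ∉ Cs u) (r-missing-at-u : Missing col u r)
             (c∉Csu : c ∉ Cs u) (c-unblocked : c ∉ blocked r) where

      c∉Csv : c ∉ Cs v
      c∉Csv = c-unblocked ∘ p⊆p∪q _

      c-missing-at-v : Missing col v c
      c-missing-at-v z vz≡c with anchored vz≡c
      ... | inj₁ Pv = ¬Pv Pv
      ... | inj₂ Pz = c-unblocked (q⊆p∪q (Cs v) _ (p⊆p∪q _ (image⁺ {g = col v} (P⊆U Pz) vz≡c)))

      colour-directly : Missing col u c → Extension P col u v
      colour-directly c-missing-at-u =
        assign col u v c , assign-admissible adm u~v c∉Csu c∉Csv c-missing-at-u c-missing-at-v (inj₁ Pu) ,
        ⊑-assign , c , assign-colours col u v c

      recolour-then-colour : ∀ {v'} → col u v' ≡ just c → Extension P col u v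
      recolour-then-colour {v'} uv'≡c =
        col₂ , adm₂ , ⊑-trans ⊑-assign ⊑-assign , c , assign-colours col₁ u v c
        where
        r∉Csv' : r ∉ Cs v'
        r∉Csv' r∈Csv' = c-unblocked (blocked⁺ (unsafe⁺ (inj₂ (inj₂ r∈Csv'))) uv'≡c)

        r-missing-at-v' : Missing col v' r
        r-missing-at-v' w v'w≡r with anchored v'w≡r
        ... | inj₁ Pv' = c-unblocked (blocked⁺ (unsafe⁺ (inj₁ (P⊆U Pv'))) uv'≡c)
        ... | inj₂ Pw  = c-unblocked (blocked⁺ (unsafe⁺ (inj₂ (inj₁ v'-partner))) uv'≡c)
          where
          v'-partner : v' ∈ image U (partner col r)
          v'-partner = image⁺ {g = partner col r} (P⊆U Pw) (partner-spec adm (trans (symmetric w v') v'w≡r))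

        c≢r : c ≢ r
        c≢r refl = r-missing-at-u v' uv'≡c

        col₁ col₂ : PartialColouring n k
        col₁ = assign col u v' r
        col₂ = assign col₁ u v c

        adm₁ : Admissible H Cs P col₁
        adm₁ = assign-admissible adm (on-edges uv'≡c) r∉Csu r∉Csv' r-missing-at-u r-missing-at-v' (inj₁ Pu)

        adm₂ : Admissible H Cs P col₂
        adm₂ = assign-admissible adm₁ u~v c∉Csu c∉Csv c-missing-at-u c-missing-at-v′ (inj₁ Pu)
          where
          c-missing-at-u : Missing col₁ u c
          c-missing-at-u = Missing-assign {col = col} {a = u} (λ uz≡c → inj₁ (refl , proper uz≡c uv'≡c)) c≢r
          c-missing-at-v′ : Missing col₁ v c
          c-missing-at-v′ = Missing-assign {col = col} {a = v} (λ {z} → ⊥-elim ∘ c-missing-at-v z) c≢r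

      extend-with : Extension P col u v
      extend-with with any? (λ z → ≡-dec-Maybe _≟_ (col u z) (just c))
      ... | yes (v' , uv'≡c) = recolour-then-colour uv'≡c
      ... | no none          = colour-directly (λ z uz≡c → none (z , uz≡c))

    extend : Extension P col u v
    extend with ∣p∣<∣q∣⇒∃∈q∖p ∣used-at-u∣<∣free∣
    ... | r , r-free , r-unused with ∣p∣<∣q∣⇒∃∈q∖p (∣blocked∣<∣free∣ r)
    ...   | c , c-free , c-unblocked =
      extend-with (x∈∁p⇒x∉p r-free) (unused⇒missing r-unused) (x∈∁p⇒x∉p c-free) c-unblocked

  colour-edge : ∀ {P} → (∀ {x} → P x → x ∈ U) → ∀ {col i y} → Admissible H Cs P col → P i → i ~[ H ] y →
                (P y → Coloured col i y) → Extension P col i y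
  colour-edge P⊆U {col} {i} {y} adm Pi i~y coloured-if-P with col i y in iy
  ... | just c  = col , adm , ⊑-refl , c , iy
  ... | nothing = extend P⊆U adm i~y Pi (λ Py → case coloured-if-P Py of λ { (_ , ()) }) iy

  colour-star : ∀ {P} → (∀ {x} → P x → x ∈ U) → ∀ {col i} → Admissible H Cs P col → P i →
                (∀ {y} → i ~[ H ] y → P y → Coloured col i y) →
                ∃ λ col' → Admissible H Cs P col' × col ⊑ col' × (∀ {y} → i ~[ H ] y → Coloured col' i y)
  colour-star {P} P⊆U {col} {i} adm Pi done = all-neighbours (colour-neighbours (allFin n))
    where
    Star : List (Fin n) → Set
    Star ys = ∃ λ col' → Admissible H Cs P col' × col ⊑ col' ×
                         (∀ {y} → y ∈ᴸ ys → i ~[ H ] y → Coloured col' i y)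
    colour-neighbours : ∀ ys → Star ys
    colour-neighbours [] = col , adm , ⊑-refl , λ ()
    colour-neighbours (y ∷ ys) with colour-neighbours ys | y ∈? adj H i
    ... | col' , adm' , col⊑col' , star | no ¬i~y =
      col' , adm' , col⊑col' , λ { (here refl) i~y → ⊥-elim (¬i~y i~y) ; (there z∈ys) → star z∈ys }
    ... | col' , adm' , col⊑col' , star | yes i~y
      with colour-edge P⊆U adm' Pi i~y (col⊑col' i y ∘ done i~y)
    ...   | col'' , adm'' , col'⊑col'' , iy-coloured =
      col'' , adm'' , ⊑-trans col⊑col' col'⊑col'' ,
      λ { (here refl) _ → iy-coloured ; (there z∈ys) i~z → col'⊑col'' i _ (star z∈ys i~z) }
    all-neighbours : Star (allFin n) →
      ∃ λ col' → Admissible H Cs P col' × col ⊑ col' × (∀ {y} → i ~[ H ] y → Coloured col' i y)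
    all-neighbours (col' , adm' , col⊑col' , star) = col' , adm' , col⊑col' , star (∈-allFin _)

  ColouringOf : List (Fin n) → Set
  ColouringOf xs = ∃ λ col → Admissible H Cs (_∈ᴸ xs) col × Covers H (_∈ᴸ xs) col

  edges-to-treated : ∀ {x xs col} → Admissible H Cs (_∈ᴸ xs) col → Covers H (_∈ᴸ xs) col →
                     ∀ {y} → x ~[ H ] y → y ∈ᴸ x ∷ xs → Coloured col x y
  edges-to-treated {x} adm covers x~x (here refl)  = ⊥-elim (Graph.irrefl H x x~x)
  edges-to-treated {x} adm covers x~y (there y∈xs) = Coloured-swap adm (covers (Graph.sym H x _ x~y) y∈xs)

  add-vertex : ∀ {x xs} → All (_∈ U) (x ∷ xs) → ColouringOf xs → ColouringOf (x ∷ xs)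
  add-vertex x∷xs⊆U (col , adm , covers)
    with colour-star (All.lookup x∷xs⊆U) (Admissible-anchor-mono adm there) (here refl)
                     (edges-to-treated adm covers)
  ... | col' , adm' , col⊑col' , star =
    col' , adm' , λ { a~b (here refl) → star a~b ; a~b (there a∈xs) → col⊑col' _ _ (covers a~b a∈xs) }

  colour-vertices : ∀ xs → All (_∈ U) xs → ColouringOf xs
  colour-vertices []       []     = (λ _ _ → nothing) , empty-admissible , λ _ ()
  colour-vertices (x ∷ xs) x∷xs⊆U = add-vertex x∷xs⊆U (colour-vertices xs (All.tail x∷xs⊆U))

  edge-colouring : (∀ u v → u ~[ H ] v → (u ∈ U) ⊎ (v ∈ U)) →
    Σ (Fin n → Fin n → Fin k) (λ φ → IsEdgeColouring H φ × IsProper H φ × Avoids H Cs φ)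
  edge-colouring U-covers
    with colour-vertices (filter (_∈? U) (allFin n)) (all-filter (_∈? U) (allFin n))
  ... | col , adm , covers = complete-colouring some-colour adm total
    where
    listed : ∀ {x} → x ∈ U → x ∈ᴸ filter (_∈? U) (allFin n)
    listed = ∈-filter⁺ (_∈? U) (∈-allFin _)
    total : ∀ {u v} → u ~[ H ] v → Coloured col u v
    total {u} {v} u~v with U-covers u v u~v
    ... | inj₁ u∈U = covers u~v (listed u∈U)
    ... | inj₂ v∈U = Coloured-swap adm (covers (Graph.sym H u v u~v) (listed v∈U))

lemma9p2 : (p q n k : ℕ) → 0 < p → p < q →
    (H : Graph n) → (Cs : Fin n → Subset k) →
    7 * p * n ≤ q * k →
    (∀ w → deg H w ≤ k ∸ ∣ Cs w ∣) →
    Σ (Subset n) (λ U → (q * ∣ U ∣ ≤ p * n) ×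
        (∀ u v → u ~[ H ] v → (u ∈ U) ⊎ (v ∈ U))) →
    (∀ w → q * ∣ Cs w ∣ ≤ p * n) →
    (∀ c → q * holders Cs c ≤ p * n) →
    Σ (Fin n → Fin n → Fin k) (λ φ →
      IsEdgeColouring H φ × IsProper H φ × Avoids H Cs φ)
lemma9p2 zero    _ _       _ ()
lemma9p2 (suc p) _ zero    _ _ _ _ _ _ _ _ _ _ = (λ ()) , (λ ()) , (λ ()) , (λ ())
lemma9p2 (suc p) q (suc n) k _ _ H Cs 7δn≤qk deg≤ (U , U-small , U-covers) Cs-small holders-small =
  Construction.edge-colouring H Cs U q (suc p * suc n) (s≤s z≤n)
    (subst (_≤ q * k) (*-assoc 7 (suc p) (suc n)) 7δn≤qk) U-small Cs-small holders-small deg≤ U-covers
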